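{- Let $G$ be a minimal counterexample as described in the context. Then $G$ contains no vertex $v$ of degree $8$ together with distinct neighbours $w_1,w_2,w_3,w_4,u$ of $v$ and a vertex $x\notin N(v)\cup\{v\}$ such that $w_1w_2,\ w_3w_4,\ xw_2,\ xw_3\in E(G)$, $d(w_2)=d(w_3)=3$ and $d(u)=2$.
   Context: A total $9$-coloring of a graph assigns to every vertex and every edge one of $9$ colors so that adjacent vertices, edges sharing an endpoint, and a vertex and an edge incident to it all receive different colors. A $4$-fan is a path $x_1x_2x_3x_4x_5$ together with one further vertex adjacent to all of $x_1,\dots,x_5$. A minimal counterexample is a simple planar graph $G$ of maximum degree $8$ containing no subgraph isomorphic to a $4$-fan, having no total $9$-coloring, with $|V(G)|+|E(G)|$ minimum among all such graphs; as part of this standing assumption, for every $x\in V(G)\cup E(G)$ the graph $G-x$ admits a total $9$-coloring. $N(v)$ is the neighbourhood of $v$ and $d(\cdot)$ denotes degree. (In the paper this is the configuration of Figure 6(d).) -}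

module Defs where

open import Data.Nat using (ℕ; zero; suc; _+_; _≤_; _<ᵇ_)
open import Data.Bool using (Bool; true; false; _∧_; _∨_; not; if_then_else_; _xor_)
open import Data.Fin using (Fin; toℕ; punchIn; _≟_)
open import Data.List using (List; map; allFin)
open import Data.Nat.ListAction using (sum)
open import Data.Maybe using (Maybe; just)
open import Data.Product using (Σ; ∃; _×_; _,_; ∃-syntax)
open import Data.Unit using (⊤)
open import Relation.Nullary using (¬_; yes; no)
open import Relation.Nullary.Decidable using (⌊_⌋)
open import Relation.Binary.PropositionalEquality using (_≡_; _≢_; refl; sym)

record Graph (n : ℕ) : Set where
  field
    adj     : Fin n → Fin n → Bool
    adj-sym : ∀ u v → adj u v ≡ adj v u
    irrefl  : ∀ v → adj v v ≡ false

open Graph public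

E : ∀ {n} → Graph n → Fin n → Fin n → Set
E G u v = adj G u v ≡ true

deg : ∀ {n} → Graph n → Fin n → ℕ
deg {n} G v = sum (map (λ u → if adj G v u then 1 else 0) (allFin n))

edgeCount : ∀ {n} → Graph n → ℕ
edgeCount {n} G =
  sum (map (λ u → sum (map (λ v → if adj G u v ∧ (toℕ u <ᵇ toℕ v) then 1 else 0)
                            (allFin n)))
           (allFin n))

size : ∀ {n} → Graph n → ℕ
size {n} G = n + edgeCount G

deleteVertex : ∀ {n} → Graph (suc n) → Fin (suc n) → Graph n
deleteVertex G v = record
  { adj     = λ a b → adj G (punchIn v a) (punchIn v b)
  ; adj-sym = λ a b → adj-sym G (punchIn v a) (punchIn v b)
  ; irrefl  = λ a → irrefl G (punchIn v a)
  }

private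
  eqb : ∀ {n} → Fin n → Fin n → Bool
  eqb a b = ⌊ a ≟ b ⌋

  isPair : ∀ {n} → Fin n → Fin n → Fin n → Fin n → Bool
  isPair u w a b = (eqb a u ∧ eqb b w) ∨ (eqb a w ∧ eqb b u)

  ∨-comm' : ∀ x y → (x ∨ y) ≡ (y ∨ x)
  ∨-comm' false false = refl
  ∨-comm' false true  = refl
  ∨-comm' true  false = refl
  ∨-comm' true  true  = refl

  ∧-comm' : ∀ x y → (x ∧ y) ≡ (y ∧ x)
  ∧-comm' false false = refl
  ∧-comm' false true  = refl
  ∧-comm' true  false = refl
  ∧-comm' true  true  = refl

  isPair-sym : ∀ {n} (u w a b : Fin n) → isPair u w a b ≡ isPair u w b a
  isPair-sym u w a b
    rewrite ∧-comm' (eqb a u) (eqb b w) | ∧-comm' (eqb a w) (eqb b u)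
    = ∨-comm' (eqb b w ∧ eqb a u) (eqb b u ∧ eqb a w)

  ∧-false : ∀ x → (false ∧ x) ≡ false
  ∧-false x = refl

deleteEdge : ∀ {n} → Graph n → Fin n → Fin n → Graph n
deleteEdge G u w = record
  { adj     = λ a b → adj G a b ∧ not (isPair u w a b)
  ; adj-sym = λ a b → sym′ a b
  ; irrefl  = λ a → irr a
  }
  where
  sym′ : ∀ a b → (adj G a b ∧ not (isPair u w a b)) ≡ (adj G b a ∧ not (isPair u w b a))
  sym′ a b rewrite adj-sym G a b | isPair-sym u w a b = refl
  irr : ∀ a → (adj G a a ∧ not (isPair u w a a)) ≡ false
  irr a rewrite irrefl G a = refl

record TotalColoring {n} (G : Graph n) (k : ℕ) : Set where
  field
    vcol : Fin n → Fin k
    ecol : Fin n → Fin n → Fin k          -- only meaningful on edges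
    ecol-sym    : ∀ u v → E G u v → ecol u v ≡ ecol v u
    vert-proper : ∀ u v → E G u v → vcol u ≢ vcol v
    edge-proper : ∀ u v w → E G u v → E G u w → v ≢ w → ecol u v ≢ ecol u w
    incid-proper : ∀ u v → E G u v → vcol u ≢ ecol u v

TotallyColorable : ∀ {n} → Graph n → ℕ → Set
TotallyColorable G k = TotalColoring G k

MaxDegree : ∀ {n} → Graph n → ℕ → Set
MaxDegree G Δ = (∀ v → deg G v ≤ Δ) × (∃[ v ] deg G v ≡ Δ)

Has4Fan : ∀ {n} → Graph n → Set
Has4Fan {n} G =
  Σ (Fin n) λ c → Σ (Fin n) λ x1 → Σ (Fin n) λ x2 → Σ (Fin n) λ x3 →
  Σ (Fin n) λ x4 → Σ (Fin n) λ x5 →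
    (c ≢ x1 × c ≢ x2 × c ≢ x3 × c ≢ x4 × c ≢ x5 ×
     x1 ≢ x2 × x1 ≢ x3 × x1 ≢ x4 × x1 ≢ x5 ×
     x2 ≢ x3 × x2 ≢ x4 × x2 ≢ x5 ×
     x3 ≢ x4 × x3 ≢ x5 ×
     x4 ≢ x5) ×
    (E G x1 x2 × E G x2 x3 × E G x3 x4 × E G x4 x5) ×
    (E G c x1 × E G c x2 × E G c x3 × E G c x4 × E G c x5)

-- Planarity (Wagner): no K5 minor and no K3,3 minor

data WalkIn {n} (G : Graph n) (P : Fin n → Set) : Fin n → Fin n → Set where
  here : ∀ {a} → WalkIn G P a a
  step : ∀ {a c b} → E G a c → P c → WalkIn G P c b → WalkIn G P a b

-- a minor model of H in G: disjoint nonempty connected branch sets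
-- (br a ≡ just i means a lies in the branch set of i), with an edge of G
-- between the branch sets of any two adjacent vertices of H
record MinorModel {n k} (G : Graph n) (H : Graph k) : Set where
  field
    br        : Fin n → Maybe (Fin k)
    nonempty  : ∀ i → ∃[ a ] br a ≡ just i
    connected : ∀ i a b → br a ≡ just i → br b ≡ just i →
                WalkIn G (λ c → br c ≡ just i) a b
    edges     : ∀ i j → E H i j →
                ∃[ a ] ∃[ b ] (br a ≡ just i × br b ≡ just j × E G a b)

HasMinor : ∀ {n k} → Graph n → Graph k → Set
HasMinor G H = MinorModel G H

K5 : Graph 5
K5 = record { adj = λ i j → not (eqb i j) ; adj-sym = s ; irrefl = r }
  where
  s : ∀ i j → not (eqb i j) ≡ not (eqb j i)
  s i j with i ≟ j | j ≟ i
  ... | yes _ | yes _ = refl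
  ... | no _  | no _  = refl
  ... | yes p | no q  = Data.Empty.⊥-elim (q (sym p))
    where import Data.Empty
  ... | no q  | yes p = Data.Empty.⊥-elim (q (sym p))
    where import Data.Empty
  r : ∀ i → not (eqb i i) ≡ false
  r i with i ≟ i
  ... | yes _ = refl
  ... | no q  = Data.Empty.⊥-elim (q refl)
    where import Data.Empty

K33 : Graph 6
K33 = record { adj = λ i j → side i xor side j ; adj-sym = λ i j → xc (side i) (side j)
             ; irrefl = λ i → xx (side i) }
  where
  side : Fin 6 → Bool
  side i = toℕ i <ᵇ 3
  xc : ∀ x y → (x xor y) ≡ (y xor x)
  xc false false = refl
  xc false true  = refl
  xc true  false = refl
  xc true  true  = refl
  xx : ∀ x → (x xor x) ≡ false
  xx false = refl
  xx true  = refl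

Planar : ∀ {n} → Graph n → Set
Planar G = ¬ HasMinor G K5 × ¬ HasMinor G K33

InClass : ∀ {n} → Graph n → Set
InClass G = Planar G × MaxDegree G 8 × ¬ Has4Fan G

VertexDeletionsColorable : ∀ {n} → Graph n → Set
VertexDeletionsColorable {zero}  G = ⊤
VertexDeletionsColorable {suc m} G = ∀ v → TotallyColorable (deleteVertex G v) 9

EdgeDeletionsColorable : ∀ {n} → Graph n → Set
EdgeDeletionsColorable G = ∀ u w → E G u w → TotallyColorable (deleteEdge G u w) 9

record MinimalCounterexample {n} (G : Graph n) : Set₁ where
  field
    inClass      : InClass G
    notColorable : ¬ TotallyColorable G 9
    minimal      : ∀ {m} (H : Graph m) → InClass H → ¬ TotallyColorable H 9 →
                   size G ≤ size H
    vertexDel    : VertexDeletionsColorable G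
    edgeDel      : EdgeDeletionsColorable G

Config6d : ∀ {n} → Graph n → Set
Config6d {n} G =
  Σ (Fin n) λ v → Σ (Fin n) λ w1 → Σ (Fin n) λ w2 → Σ (Fin n) λ w3 →
  Σ (Fin n) λ w4 → Σ (Fin n) λ u → Σ (Fin n) λ x →
    deg G v ≡ 8 ×
    (w1 ≢ w2 × w1 ≢ w3 × w1 ≢ w4 × w1 ≢ u ×
     w2 ≢ w3 × w2 ≢ w4 × w2 ≢ u ×
     w3 ≢ w4 × w3 ≢ u ×
     w4 ≢ u) ×
    (E G v w1 × E G v w2 × E G v w3 × E G v w4 × E G v u) ×
    (x ≢ v × ¬ E G v x) ×
    (E G w1 w2 × E G w3 w4 × E G x w2 × E G x w3) ×
    (deg G w2 ≡ 3 × deg G w3 ≡ 3 × deg G u ≡ 2)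

{-# OPTIONS --safe #-}
module Submission where

-- Delete the edge uv and take a total 9-colouring ψ of G − uv.  In G − uv the vertex v has
-- degree 7, so some colour α is missing at v; let s be the colour of the other edge at u.
-- Recolour the nine edges vu, vw₁, …, vw₄, w₁w₂, xw₂, w₃w₄, xw₃ so that vu avoids s: if
-- α ≠ s put α on vu, otherwise give vu the colour of some vwᵢ and α to vwᵢ, exchanging the
-- two colours at w₁, w₄ or x where this would clash.  At v, w₁, w₄ and x only colours already
-- present there are used, so conflicts can only arise at u, w₂ and w₃; these are uncoloured
-- and recoloured last, which is possible because a vertex of degree d ≤ 4 sees only 2d < 9
-- colours.

open import Defs
open import Data.Bool using (Bool; true; false; if_then_else_)
import Data.Bool as Bool
open import Data.Fin using (Fin; zero; suc; _≟_)
open import Data.Fin.Properties using (any?; all?; ¬∀⟶∃¬; injective⇒≤)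
open import Data.List using (List; []; _∷_; _++_; map; filter; allFin; length; lookup)
open import Data.List.Properties using (length-map; length-++; length-tabulate)
open import Data.List.Membership.Propositional using (_∈_; _∉_)
open import Data.List.Membership.Propositional.Properties
  using (∈-allFin; ∈-filter⁺; ∈-filter⁻; ∈-lookup; ∈-map⁺; ∈-++⁺ˡ; ∈-++⁺ʳ)
open import Data.List.Membership.Setoid.Properties using (index-injective)
open import Data.List.Relation.Binary.Permutation.Propositional
  using (_↭_; ↭-refl; ↭-prep; ↭-swap; ↭-trans; ↭-sym; ↭⇒↭ₛ)
open import Data.List.Relation.Binary.Permutation.Propositional.Properties using (shift; ∈-resp-↭)
import Data.List.Relation.Binary.Permutation.Setoid.Properties as PermutationProperties
open import Data.List.Relation.Binary.Subset.Propositional using (_⊆_)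
open import Data.List.Relation.Unary.All as All using (All; []; _∷_)
open import Data.List.Relation.Unary.All.Properties using (¬Any⇒All¬) renaming (map⁺ to All-map⁺)
open import Data.List.Relation.Unary.AllPairs using ([]; _∷_)
open import Data.List.Relation.Unary.Any as Any using (here; there)
open import Data.List.Relation.Unary.Unique.Propositional using (Unique)
open import Data.List.Relation.Unary.Unique.Propositional.Properties
  using (filter⁺; allFin⁺) renaming (map⁺ to Unique-map⁺)
import Data.List.Relation.Unary.Unique.DecPropositional as DecUnique
open import Data.Maybe using (Maybe; just; nothing; is-just; fromMaybe)
open import Data.Maybe.Properties using (≡-dec)
open import Data.Nat using (ℕ; suc; _+_; _*_; _≤_; _<_; s≤s)
open import Data.Nat.ListAction using (sum)
open import Data.Nat.Properties using (_<?_; ≤-refl; ≤-pred; ≤-antisym; <⇒≱; +-identityʳ)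
open import Data.Product using (∃-syntax; _×_; _,_; proj₁; proj₂)
open import Data.Sum using (_⊎_; inj₁; inj₂)
open import Data.Vec using ([]; _∷_)
import Data.Vec as Vec
open import Data.Vec.Relation.Unary.All using ([]; _∷_)
open import Data.Vec.Relation.Unary.AllPairs using ([]; _∷_)
import Data.Vec.Relation.Unary.Unique.Propositional as VecUnique
import Data.Vec.Relation.Unary.Unique.Propositional.Properties as VecUniqueProperties
open import Function using (_∘_)
open import Relation.Binary.Definitions using (DecidableEquality)
open import Relation.Binary.PropositionalEquality
  using (_≡_; _≢_; refl; sym; trans; cong; cong₂; subst; subst₂; ≢-sym; setoid; module ≡-Reasoning)
open import Relation.Nullary using (¬_; Dec; yes; no; contradiction; _×-dec_)
open import Relation.Nullary.Decidable using (toSum; from-yes; _→-dec_)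

module _ {A : Set} where

  Unique⇒lookup-injective : ∀ {xs : List A} → Unique xs → ∀ {i j} → lookup xs i ≡ lookup xs j → i ≡ j
  Unique⇒lookup-injective (_ ∷ _) {zero} {zero} _ = refl
  Unique⇒lookup-injective (x∉xs ∷ _) {zero} {suc j} eq = contradiction eq (All.lookup x∉xs (∈-lookup j))
  Unique⇒lookup-injective (x∉xs ∷ _) {suc i} {zero} eq = contradiction (sym eq) (All.lookup x∉xs (∈-lookup i))
  Unique⇒lookup-injective (_ ∷ xs!) {suc i} {suc j} eq = cong suc (Unique⇒lookup-injective xs! eq)

  Unique-⊆⇒length≤ : ∀ {xs ys : List A} → Unique xs → xs ⊆ ys → length xs ≤ length ys
  Unique-⊆⇒length≤ xs! xs⊆ys = injective⇒≤ λ eq →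
    Unique⇒lookup-injective xs! (index-injective (setoid A) (xs⊆ys (∈-lookup _)) (xs⊆ys (∈-lookup _)) eq)

  Unique-map⇒≢ : ∀ {B : Set} (f : A → B) {xs x y} → Unique (map f xs) →
                 x ∈ xs → y ∈ xs → x ≢ y → f x ≢ f y
  Unique-map⇒≢ f {_ ∷ _} _ (here refl) (here refl) x≢y = contradiction refl x≢y
  Unique-map⇒≢ f {_ ∷ _} (fx∉ ∷ _) (here refl) (there y∈) _ = All.lookup fx∉ (∈-map⁺ f y∈)
  Unique-map⇒≢ f {_ ∷ _} (fy∉ ∷ _) (there x∈) (here refl) _ = ≢-sym (All.lookup fy∉ (∈-map⁺ f x∈))
  Unique-map⇒≢ f {_ ∷ _} (_ ∷ u) (there x∈) (there y∈) x≢y = Unique-map⇒≢ f u x∈ y∈ x≢y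

  sum-indicator≡length-filter : (f : A → Bool) (xs : List A) →
                  sum (map (λ x → if f x then 1 else 0) xs) ≡ length (filter (λ x → f x Bool.≟ true) xs)
  sum-indicator≡length-filter f [] = refl
  sum-indicator≡length-filter f (x ∷ xs) with f x
  ... | true  = cong suc (sum-indicator≡length-filter f xs)
  ... | false = sum-indicator≡length-filter f xs

  ↭-exchange : ∀ (x : A) xs y ys → x ∷ xs ++ y ∷ ys ↭ y ∷ xs ++ x ∷ ys
  ↭-exchange x xs y ys =
    ↭-trans (↭-prep x (shift y xs ys)) (↭-trans (↭-swap x y ↭-refl) (↭-prep y (↭-sym (shift x xs ys))))

  Unique-resp-↭ : ∀ {xs ys : List A} → xs ↭ ys → Unique xs → Unique ys
  Unique-resp-↭ xs↭ys = PermutationProperties.Unique-resp-↭ (setoid A) (↭⇒↭ₛ xs↭ys)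


missing-colour : ∀ {k} (cs : List (Fin k)) → length cs < k → ∃[ c ] c ∉ cs
missing-colour {k} cs short = ¬∀⟶∃¬ k (_∈ cs) (λ c → Any.any? (c ≟_) cs) λ all∈ →
  <⇒≱ short (subst (_≤ length cs) (length-tabulate _) (Unique-⊆⇒length≤ (allFin⁺ k) λ {c} _ → all∈ c))

module _ {n} (G : Graph n) where

  E-sym : ∀ {p q} → E G p q → E G q p
  E-sym {p} {q} e = trans (adj-sym G q p) e

  E-irrefl : ∀ {p q} → E G p q → p ≢ q
  E-irrefl {p} e refl with () ← trans (sym e) (irrefl G p)

  E? : ∀ p q → Dec (E G p q)
  E? p q = adj G p q Bool.≟ true

  neighbours : Fin n → List (Fin n)
  neighbours p = filter (E? p) (allFin n)

  ∈-neighbours⁺ : ∀ {p q} → E G p q → q ∈ neighbours p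
  ∈-neighbours⁺ {p} {q} e = ∈-filter⁺ (E? p) (∈-allFin q) e

  ∈-neighbours⁻ : ∀ {p q} → q ∈ neighbours p → E G p q
  ∈-neighbours⁻ {p} = proj₂ ∘ ∈-filter⁻ (E? p) {xs = allFin n}

  neighbours-unique : ∀ p → Unique (neighbours p)
  neighbours-unique p = filter⁺ _ (allFin⁺ n)

  deg≡length-neighbours : ∀ p → deg G p ≡ length (neighbours p)
  deg≡length-neighbours p = sum-indicator≡length-filter (adj G p) (allFin n)

  distinct-neighbours≤deg : ∀ {p qs} → Unique qs → All (E G p) qs → length qs ≤ deg G p
  distinct-neighbours≤deg {p} qs! adjacent =
    subst (_ ≤_) (sym (deg≡length-neighbours p)) (Unique-⊆⇒length≤ qs! (∈-neighbours⁺ ∘ All.lookup adjacent))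

  neighbour-among : ∀ {p qs r} → Unique qs → All (E G p) qs → deg G p ≡ length qs → E G p r → r ∈ qs
  neighbour-among {qs = qs} {r} qs! adjacent d e with Any.any? (r ≟_) qs
  ... | yes r∈qs = r∈qs
  ... | no r∉qs = contradiction (subst (suc (length qs) ≤_) d
                    (distinct-neighbours≤deg (¬Any⇒All¬ qs r∉qs ∷ qs!) (e ∷ adjacent))) (<⇒≱ ≤-refl)

  sole-neighbour : ∀ {p} → deg G p ≤ 1 → ∃[ z ] ∀ {q} → E G p q → q ≡ z
  sole-neighbour {p} d with any? (E? p)
  ... | no none = p , λ {q} e → contradiction (q , e) none
  ... | yes (z , e) = z , λ e′ → the-only (neighbour-among ([] ∷ []) (e ∷ []) deg≡1 e′)
    where
    deg≡1 : deg G p ≡ 1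
    deg≡1 = ≤-antisym d (distinct-neighbours≤deg ([] ∷ []) (e ∷ []))
    the-only : ∀ {q} → q ∈ z ∷ [] → q ≡ z
    the-only (here q≡z) = q≡z

deg-subgraph-< : ∀ {n} {G H : Graph n} {p r} → (∀ {q} → E H p q → E G p q) →
                 E G p r → ¬ E H p r → deg H p < deg G p
deg-subgraph-< {G = G} {H} {p} H⊆G e ¬e′ =
  subst (_≤ deg G p) (cong suc (sym (deg≡length-neighbours H p)))
    (distinct-neighbours≤deg G (¬Any⇒All¬ _ (¬e′ ∘ ∈-neighbours⁻ H) ∷ neighbours-unique H p)
                               (e ∷ All.tabulate (H⊆G ∘ ∈-neighbours⁻ H)))

module _ {n} (G : Graph n) (u w : Fin n) where

  deleteEdge-⊆ : ∀ {p q} → E (deleteEdge G u w) p q → E G p q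
  deleteEdge-⊆ {p} {q} e with adj G p q | e
  ... | true  | _ = refl
  ... | false | ()

  deleteEdge-removes : ¬ E (deleteEdge G u w) u w
  deleteEdge-removes with adj G u w | u ≟ u | w ≟ w
  ... | false | _     | _     = λ ()
  ... | true  | yes _ | yes _ = λ ()
  ... | true  | no ¬u | _     = contradiction refl ¬u
  ... | true  | _     | no ¬w = contradiction refl ¬w

  deleteEdge-only-uw : ∀ {p q} → E G p q → ¬ E (deleteEdge G u w) p q → (p ≡ u × q ≡ w) ⊎ (p ≡ w × q ≡ u)
  deleteEdge-only-uw {p} {q} e ¬e′ with adj G p q | e | p ≟ u | q ≟ w | p ≟ w | q ≟ u
  ... | .true | refl | yes p≡u | yes q≡w | _       | _       = inj₁ (p≡u , q≡w)
  ... | .true | refl | _       | _       | yes p≡w | yes q≡u = inj₂ (p≡w , q≡u)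
  ... | .true | refl | no _    | _       | no _    | _       = contradiction refl ¬e′
  ... | .true | refl | no _    | _       | yes _   | no _    = contradiction refl ¬e′
  ... | .true | refl | yes _   | no _    | no _    | _       = contradiction refl ¬e′
  ... | .true | refl | yes _   | no _    | yes _   | no _    = contradiction refl ¬e′

missing-at : ∀ {n k} {H : Graph n} (ψ : TotalColoring H k) p → suc (deg H p) < k →
             ∃[ c ] (TotalColoring.vcol ψ p ≢ c × ∀ {r} → E H p r → TotalColoring.ecol ψ p r ≢ c)
missing-at {k = k} {H} ψ p small =
  let c , c∉ = missing-colour seen short
  in c , (λ vcol≡c → c∉ (here (sym vcol≡c)))
       , λ e ecol≡c → c∉ (there (subst (_∈ _) ecol≡c (∈-map⁺ (ecol p) (∈-neighbours⁺ H e))))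
  where
  open TotalColoring ψ
  seen : List (Fin k)
  seen = vcol p ∷ map (ecol p) (neighbours H p)
  short : length seen < k
  short = subst (λ d → suc d < k)
                (trans (deg≡length-neighbours H p) (sym (length-map (ecol p) (neighbours H p)))) small

record TotalColoringExcept {n} (G : Graph n) (k : ℕ) (S : List (Fin n)) : Set where
  field
    vcol : Fin n → Fin k
    ecol : Fin n → Fin n → Fin k
    ecol-sym     : ∀ p q → E G p q → ecol p q ≡ ecol q p
    vert-proper  : ∀ p q → E G p q → p ∉ S → q ∉ S → vcol p ≢ vcol q
    edge-proper  : ∀ p q r → E G p q → E G p r → q ≢ r → ecol p q ≢ ecol p r
    incid-proper : ∀ p q → E G p q → p ∉ S → vcol p ≢ ecol p q

module _ {n k : ℕ} {G : Graph n} where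

  recolour-vertex : ∀ {p S} → 2 * deg G p < k →
                    TotalColoringExcept G k (p ∷ S) → TotalColoringExcept G k S
  recolour-vertex {p} {S} small χ = record
    { vcol = vcol′ ; ecol = ecol ; ecol-sym = ecol-sym ; edge-proper = edge-proper
    ; vert-proper = vert-proper′ ; incid-proper = incid-proper′ }
    where
    open TotalColoringExcept χ
    open ≡-Reasoning

    N = neighbours G p

    forbidden : List (Fin k)
    forbidden = map vcol N ++ map (ecol p) N

    length-forbidden : length forbidden ≡ 2 * deg G p
    length-forbidden = begin
      length (map vcol N ++ map (ecol p) N)        ≡⟨ length-++ (map vcol N) ⟩
      length (map vcol N) + length (map (ecol p) N) ≡⟨ cong₂ _+_ (length-map vcol N) (length-map (ecol p) N) ⟩
      length N + length N                          ≡⟨ cong (λ d → d + d) (sym (deg≡length-neighbours G p)) ⟩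
      deg G p + deg G p                            ≡⟨ cong (deg G p +_) (sym (+-identityʳ (deg G p))) ⟩
      2 * deg G p                                  ∎

    choice : ∃[ c ] c ∉ forbidden
    choice = missing-colour forbidden (subst (_< k) (sym length-forbidden) small)

    c = proj₁ choice
    c∉forbidden = proj₂ choice

    vcol′ : Fin n → Fin k
    vcol′ q with q ≟ p
    ... | yes _ = c
    ... | no _  = vcol q

    c≢vcol : ∀ {q} → E G p q → c ≢ vcol q
    c≢vcol e c≡ = c∉forbidden (subst (_∈ forbidden) (sym c≡) (∈-++⁺ˡ (∈-map⁺ vcol (∈-neighbours⁺ G e))))

    c≢ecol : ∀ {q} → E G p q → c ≢ ecol p q
    c≢ecol e c≡ = c∉forbidden
      (subst (_∈ forbidden) (sym c≡) (∈-++⁺ʳ (map vcol N) (∈-map⁺ (ecol p) (∈-neighbours⁺ G e))))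

    still-outside : ∀ {q} → q ≢ p → q ∉ S → q ∉ p ∷ S
    still-outside q≢p _ (here q≡p) = q≢p q≡p
    still-outside _ q∉S (there q∈S) = q∉S q∈S

    vert-proper′ : ∀ q r → E G q r → q ∉ S → r ∉ S → vcol′ q ≢ vcol′ r
    vert-proper′ q r e q∉S r∉S with q ≟ p | r ≟ p
    ... | yes refl | yes refl = contradiction refl (E-irrefl G e)
    ... | yes refl | no _     = c≢vcol e
    ... | no _     | yes refl = ≢-sym (c≢vcol (E-sym G e))
    ... | no q≢p   | no r≢p   = vert-proper q r e (still-outside q≢p q∉S) (still-outside r≢p r∉S)

    incid-proper′ : ∀ q r → E G q r → q ∉ S → vcol′ q ≢ ecol q r
    incid-proper′ q r e q∉S with q ≟ p
    ... | yes refl = c≢ecol e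
    ... | no q≢p   = incid-proper q r e (still-outside q≢p q∉S)

  recolour-vertices : ∀ {S} → All (λ p → 2 * deg G p < k) S → TotalColoringExcept G k S → TotalColoring G k
  recolour-vertices [] χ = record
    { vcol = vcol ; ecol = ecol ; ecol-sym = ecol-sym ; edge-proper = edge-proper
    ; vert-proper = λ p q e → vert-proper p q e (λ ()) (λ ())
    ; incid-proper = λ p q e → incid-proper p q e (λ ()) }
    where open TotalColoringExcept χ
  recolour-vertices (small ∷ smalls) χ = recolour-vertices smalls (recolour-vertex small χ)

record ProperEdgeColouring {m} (K : Graph m) (C : Set) : Set where
  field
    colour        : Fin m → Fin m → C
    colour-sym    : ∀ {i j} → E K i j → colour i j ≡ colour j i
    colour-proper : ∀ {i j j′} → E K i j → E K i j′ → j ≢ j′ → colour i j ≢ colour i j′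

EdgeImage : ∀ {m n} → Graph m → (Fin m → Fin n) → Fin n → Fin n → Set
EdgeImage K at p q = ∃[ i ] ∃[ j ] (at i ≡ p × at j ≡ q × E K i j)

module EmbeddedRecolouring {n m k} {G H : Graph n} (ψ : TotalColoring H k) (S : List (Fin n))
  {K : Graph m} (at : Fin m → Fin n) (at-injective : ∀ {i j} → at i ≡ at j → i ≡ j)
  (κ : ProperEdgeColouring K (Fin k)) where

  private
    module ψ = TotalColoring ψ
    open ProperEdgeColouring κ

  record Compatible : Set where
    field
      deleted-recoloured : ∀ {p q} → E G p q → ¬ E H p q → EdgeImage K at p q
      deleted-touches-S  : ∀ {p q} → E G p q → ¬ E H p q → p ∈ S ⊎ q ∈ S
      fresh : ∀ {i j r} → E K i j → E H (at i) r → ¬ EdgeImage K at (at i) r →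
              ψ.ecol (at i) r ≢ colour i j
      incid : ∀ {i j} → E K i j → at i ∉ S → ψ.vcol (at i) ≢ colour i j

  recolour : Compatible → TotalColoringExcept G k S
  recolour compatible = record
    { vcol = ψ.vcol ; ecol = ecol ; ecol-sym = ecol-sym ; edge-proper = edge-proper
    ; vert-proper = vert-proper ; incid-proper = incid-proper }
    where
    open Compatible compatible
    open ≡-Reasoning

    image? : ∀ p q → Dec (EdgeImage K at p q)
    image? p q = any? λ i → any? λ j → at i ≟ p ×-dec at j ≟ q ×-dec E? K i j

    image-sym : ∀ {p q} → EdgeImage K at p q → EdgeImage K at q p
    image-sym (i , j , refl , refl , e) = j , i , refl , refl , E-sym K e

    ecol : Fin n → Fin n → Fin k
    ecol p q with image? p q
    ... | yes (i , j , _) = colour i j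
    ... | no _            = ψ.ecol p q

    ecol-image : ∀ {i j} → E K i j → ecol (at i) (at j) ≡ colour i j
    ecol-image {i} {j} e with image? (at i) (at j)
    ... | no ¬image = contradiction (i , j , refl , refl , e) ¬image
    ... | yes (i′ , j′ , i′≡ , j′≡ , _) with refl ← at-injective i′≡ | refl ← at-injective j′≡ = refl

    ecol-kept : ∀ {p q} → ¬ EdgeImage K at p q → ecol p q ≡ ψ.ecol p q
    ecol-kept {p} {q} ¬image with image? p q
    ... | yes image = contradiction image ¬image
    ... | no _      = refl

    kept-in-H : ∀ {p q} → E G p q → ¬ EdgeImage K at p q → E H p q
    kept-in-H {p} {q} e ¬image with E? H p q
    ... | yes e′ = e′
    ... | no ¬e′ = contradiction (deleted-recoloured e ¬e′) ¬image

    -- Splitting on toSum (image? p q) rather than image? p q keeps ecol folded.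
    ecol-sym : ∀ p q → E G p q → ecol p q ≡ ecol q p
    ecol-sym p q e with toSum (image? p q)
    ... | inj₁ (i , j , refl , refl , eK) = begin
      ecol (at i) (at j) ≡⟨ ecol-image eK ⟩
      colour i j         ≡⟨ colour-sym eK ⟩
      colour j i         ≡⟨ ecol-image (E-sym K eK) ⟨
      ecol (at j) (at i) ∎
    ... | inj₂ ¬image = begin
      ecol p q   ≡⟨ ecol-kept ¬image ⟩
      ψ.ecol p q ≡⟨ ψ.ecol-sym p q (kept-in-H e ¬image) ⟩
      ψ.ecol q p ≡⟨ ecol-kept (¬image ∘ image-sym) ⟨
      ecol q p   ∎

    vert-proper : ∀ p q → E G p q → p ∉ S → q ∉ S → ψ.vcol p ≢ ψ.vcol q
    vert-proper p q e p∉S q∉S with E? H p q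
    ... | yes e′ = ψ.vert-proper p q e′
    ... | no ¬e′ with deleted-touches-S e ¬e′
    ...   | inj₁ p∈S = contradiction p∈S p∉S
    ...   | inj₂ q∈S = contradiction q∈S q∉S

    edge-proper : ∀ p q r → E G p q → E G p r → q ≢ r → ecol p q ≢ ecol p r
    edge-proper p q r eq er q≢r with toSum (image? p q) | toSum (image? p r)
    ... | inj₁ (i , j , refl , refl , eij) | inj₁ (i′ , j′ , i′≡ , refl , ei′j′)
        with refl ← at-injective i′≡ =
      subst₂ _≢_ (sym (ecol-image eij)) (sym (ecol-image ei′j′)) (colour-proper eij ei′j′ (q≢r ∘ cong at))
    ... | inj₁ (i , j , refl , refl , eij) | inj₂ ¬image =
      subst₂ _≢_ (sym (ecol-image eij)) (sym (ecol-kept ¬image))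
                 (≢-sym (fresh eij (kept-in-H er ¬image) ¬image))
    ... | inj₂ ¬image | inj₁ (i , j , refl , refl , eij) =
      subst₂ _≢_ (sym (ecol-kept ¬image)) (sym (ecol-image eij)) (fresh eij (kept-in-H eq ¬image) ¬image)
    ... | inj₂ ¬q | inj₂ ¬r =
      subst₂ _≢_ (sym (ecol-kept ¬q)) (sym (ecol-kept ¬r))
                 (ψ.edge-proper p q r (kept-in-H eq ¬q) (kept-in-H er ¬r) q≢r)

    incid-proper : ∀ p q → E G p q → p ∉ S → ψ.vcol p ≢ ecol p q
    incid-proper p q e p∉S with toSum (image? p q)
    ... | inj₁ (i , j , refl , refl , eij) = subst (ψ.vcol (at i) ≢_) (sym (ecol-image eij)) (incid eij p∉S)
    ... | inj₂ ¬image = subst (ψ.vcol p ≢_) (sym (ecol-kept ¬image)) (ψ.incid-proper p q (kept-in-H e ¬image))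

-- The vertices v, u, w₁, …, x of the configuration are encoded as roles in Fin 7 and its
-- nine edges as links in Fin 9, so that facts about the pattern are decided by evaluation.

Role : Set
Role = Fin 7

pattern V  = zero
pattern U  = suc zero
pattern W₁ = suc (suc zero)
pattern W₂ = suc (suc (suc zero))
pattern W₃ = suc (suc (suc (suc zero)))
pattern W₄ = suc (suc (suc (suc (suc zero))))
pattern X  = suc (suc (suc (suc (suc (suc zero)))))

Link : Set
Link = Fin 9

pattern VU   = zero
pattern VW₁  = suc zero
pattern VW₂  = suc (suc zero)
pattern VW₃  = suc (suc (suc zero))
pattern VW₄  = suc (suc (suc (suc zero)))
pattern W₁W₂ = suc (suc (suc (suc (suc zero))))
pattern XW₂  = suc (suc (suc (suc (suc (suc zero)))))
pattern W₃W₄ = suc (suc (suc (suc (suc (suc (suc zero))))))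
pattern XW₃  = suc (suc (suc (suc (suc (suc (suc (suc zero)))))))

link : Role → Role → Maybe Link
link V  U  = just VU
link V  W₁ = just VW₁
link V  W₂ = just VW₂
link V  W₃ = just VW₃
link V  W₄ = just VW₄
link W₁ W₂ = just W₁W₂
link X  W₂ = just XW₂
link W₃ W₄ = just W₃W₄
link X  W₃ = just XW₃
link U  V  = just VU
link W₁ V  = just VW₁
link W₂ V  = just VW₂
link W₃ V  = just VW₃
link W₄ V  = just VW₄
link W₂ W₁ = just W₁W₂
link W₂ X  = just XW₂
link W₄ W₃ = just W₃W₄
link W₃ X  = just XW₃
link _  _  = nothing

linksAt : Role → List Link
linksAt V  = VU ∷ VW₁ ∷ VW₂ ∷ VW₃ ∷ VW₄ ∷ []
linksAt U  = VU ∷ []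
linksAt W₁ = VW₁ ∷ W₁W₂ ∷ []
linksAt W₂ = VW₂ ∷ W₁W₂ ∷ XW₂ ∷ []
linksAt W₃ = VW₃ ∷ W₃W₄ ∷ XW₃ ∷ []
linksAt W₄ = VW₄ ∷ W₃W₄ ∷ []
linksAt X  = XW₂ ∷ XW₃ ∷ []

link-sym : ∀ i j → link i j ≡ link j i
link-sym = from-yes (all? λ i → all? λ j → ≡-dec _≟_ (link i j) (link j i))

link-irrefl : ∀ i → link i i ≡ nothing
link-irrefl = from-yes (all? λ i → ≡-dec _≟_ (link i i) nothing)

Pattern : Graph 7
Pattern = record
  { adj     = λ i j → is-just (link i j)
  ; adj-sym = λ i j → cong is-just (link-sym i j)
  ; irrefl  = λ i → cong is-just (link-irrefl i) }

-- Off the edges of the pattern linkOf returns the junk value VU.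
linkOf : Role → Role → Link
linkOf i j = fromMaybe VU (link i j)

linkOf-around : ∀ i j → E Pattern i j → linkOf i j ∈ linksAt i
linkOf-around = from-yes (all? λ i → all? λ j → E? Pattern i j →-dec Any.any? (linkOf i j ≟_) (linksAt i))

linkOf-injective : ∀ i j j′ → E Pattern i j → E Pattern i j′ → linkOf i j ≡ linkOf i j′ → j ≡ j′
linkOf-injective = from-yes (all? λ i → all? λ j → all? λ j′ →
  E? Pattern i j →-dec E? Pattern i j′ →-dec linkOf i j ≟ linkOf i j′ →-dec j ≟ j′)

record LinkColouring (C : Set) : Set where
  constructor mkLinkColouring
  field vu vw₁ vw₂ vw₃ vw₄ w₁w₂ xw₂ w₃w₄ xw₃ : C

module _ {C : Set} where

  _⟦_⟧ : LinkColouring C → Link → C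
  κ ⟦ VU   ⟧ = LinkColouring.vu κ
  κ ⟦ VW₁  ⟧ = LinkColouring.vw₁ κ
  κ ⟦ VW₂  ⟧ = LinkColouring.vw₂ κ
  κ ⟦ VW₃  ⟧ = LinkColouring.vw₃ κ
  κ ⟦ VW₄  ⟧ = LinkColouring.vw₄ κ
  κ ⟦ W₁W₂ ⟧ = LinkColouring.w₁w₂ κ
  κ ⟦ XW₂  ⟧ = LinkColouring.xw₂ κ
  κ ⟦ W₃W₄ ⟧ = LinkColouring.w₃w₄ κ
  κ ⟦ XW₃  ⟧ = LinkColouring.xw₃ κ

  around : LinkColouring C → Role → List C
  around κ i = map (κ ⟦_⟧) (linksAt i)

  pattern-colouring : (κ : LinkColouring C) → (∀ i → Unique (around κ i)) → ProperEdgeColouring Pattern C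
  pattern-colouring κ proper = record
    { colour        = λ i j → κ ⟦ linkOf i j ⟧
    ; colour-sym    = λ {i} {j} _ → cong (λ l → κ ⟦ fromMaybe VU l ⟧) (link-sym i j)
    ; colour-proper = λ {i} {j} {j′} e e′ j≢j′ →
        Unique-map⇒≢ (κ ⟦_⟧) (proper i) (linkOf-around i j e) (linkOf-around i j′ e′)
                     (j≢j′ ∘ linkOf-injective i j j′ e e′) }

module _ {C : Set} where

  record Recolouring (old : LinkColouring C) (s : C) : Set where
    field
      new       : LinkColouring C
      vu≢s      : LinkColouring.vu new ≢ s
      reuses-v  : around new V  ↭ around old V
      reuses-w₁ : around new W₁ ↭ around old W₁
      reuses-w₄ : around new W₄ ↭ around old W₄
      reuses-x  : around new X  ↭ around old X
      proper-w₂ : Unique (around new W₂)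
      proper-w₃ : Unique (around new W₃)

    proper : (∀ i → Unique (around old i)) → ∀ i → Unique (around new i)
    proper old! V  = Unique-resp-↭ (↭-sym reuses-v) (old! V)
    proper old! U  = [] ∷ []
    proper old! W₁ = Unique-resp-↭ (↭-sym reuses-w₁) (old! W₁)
    proper old! W₂ = proper-w₂
    proper old! W₃ = proper-w₃
    proper old! W₄ = Unique-resp-↭ (↭-sym reuses-w₄) (old! W₄)
    proper old! X  = Unique-resp-↭ (↭-sym reuses-x) (old! X)

  -- In via-vwᵢ the edge vu takes the old colour of vwᵢ; the -swapping-x moves also exchange the
  -- colours of the two edges at x, and the -swapping-all moves those at w₁, w₄ and x.
  module Moves (_≟ᶜ_ : DecidableEquality C) (α g₁ b₂ b₃ g₄ a b c d : C)
    (α≢g₁ : α ≢ g₁) (α≢b₂ : α ≢ b₂) (α≢b₃ : α ≢ b₃) (α≢g₄ : α ≢ g₄)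
    (g₁≢b₂ : g₁ ≢ b₂) (g₁≢b₃ : g₁ ≢ b₃) (g₁≢g₄ : g₁ ≢ g₄) (b₂≢g₄ : b₂ ≢ g₄) (b₃≢g₄ : b₃ ≢ g₄)
    (b₂≢a : b₂ ≢ a) (b₂≢b : b₂ ≢ b) (a≢b : a ≢ b)
    (b₃≢c : b₃ ≢ c) (b₃≢d : b₃ ≢ d) (c≢d : c ≢ d)
    (b≢d : b ≢ d) where

    old : LinkColouring C
    old = mkLinkColouring α g₁ b₂ b₃ g₄ a b c d

    old-w₂ : Unique (b₂ ∷ a ∷ b ∷ [])
    old-w₂ = (b₂≢a ∷ b₂≢b ∷ []) ∷ (a≢b ∷ []) ∷ [] ∷ []

    old-w₃ : Unique (b₃ ∷ c ∷ d ∷ [])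
    old-w₃ = (b₃≢c ∷ b₃≢d ∷ []) ∷ (c≢d ∷ []) ∷ [] ∷ []

    unchanged : ∀ {s} → α ≢ s → Recolouring old s
    unchanged α≢s = record
      { new = old ; vu≢s = α≢s
      ; reuses-v = ↭-refl ; reuses-w₁ = ↭-refl ; reuses-w₄ = ↭-refl ; reuses-x = ↭-refl
      ; proper-w₂ = old-w₂
      ; proper-w₃ = old-w₃ }

    via-vw₂ : α ≢ a → α ≢ b → Recolouring old α
    via-vw₂ α≢a α≢b = record
      { new = record old { vu = b₂ ; vw₂ = α } ; vu≢s = ≢-sym α≢b₂
      ; reuses-v = ↭-exchange b₂ (g₁ ∷ []) α (b₃ ∷ g₄ ∷ [])
      ; reuses-w₁ = ↭-refl ; reuses-w₄ = ↭-refl ; reuses-x = ↭-refl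
      ; proper-w₂ = (α≢a ∷ α≢b ∷ []) ∷ (a≢b ∷ []) ∷ [] ∷ []
      ; proper-w₃ = old-w₃ }

    via-vw₃ : α ≢ c → α ≢ d → Recolouring old α
    via-vw₃ α≢c α≢d = record
      { new = record old { vu = b₃ ; vw₃ = α } ; vu≢s = ≢-sym α≢b₃
      ; reuses-v = ↭-exchange b₃ (g₁ ∷ b₂ ∷ []) α (g₄ ∷ [])
      ; reuses-w₁ = ↭-refl ; reuses-w₄ = ↭-refl ; reuses-x = ↭-refl
      ; proper-w₂ = old-w₂
      ; proper-w₃ = (α≢c ∷ α≢d ∷ []) ∷ (c≢d ∷ []) ∷ [] ∷ [] }

    via-vw₁ : a ≡ α → g₁ ≢ b → Recolouring old α
    via-vw₁ refl g₁≢b = record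
      { new = record old { vu = g₁ ; vw₁ = α ; w₁w₂ = g₁ } ; vu≢s = ≢-sym α≢g₁
      ; reuses-v = ↭-swap g₁ α ↭-refl ; reuses-w₁ = ↭-swap α g₁ ↭-refl
      ; reuses-w₄ = ↭-refl ; reuses-x = ↭-refl
      ; proper-w₂ = (≢-sym g₁≢b₂ ∷ b₂≢b ∷ []) ∷ (g₁≢b ∷ []) ∷ [] ∷ []
      ; proper-w₃ = old-w₃ }

    via-vw₄ : c ≡ α → g₄ ≢ d → Recolouring old α
    via-vw₄ refl g₄≢d = record
      { new = record old { vu = g₄ ; vw₄ = α ; w₃w₄ = g₄ } ; vu≢s = ≢-sym α≢g₄
      ; reuses-v = ↭-exchange g₄ (g₁ ∷ b₂ ∷ b₃ ∷ []) α [] ; reuses-w₁ = ↭-refl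
      ; reuses-w₄ = ↭-swap α g₄ ↭-refl ; reuses-x = ↭-refl
      ; proper-w₂ = old-w₂
      ; proper-w₃ = (b₃≢g₄ ∷ b₃≢d ∷ []) ∷ (g₄≢d ∷ []) ∷ [] ∷ [] }

    via-vw₁-swapping-x : a ≡ α → b ≡ g₁ → b₂ ≢ d → c ≢ g₁ → Recolouring old α
    via-vw₁-swapping-x refl refl b₂≢d c≢g₁ = record
      { new = record old { vu = g₁ ; vw₁ = α ; w₁w₂ = g₁ ; xw₂ = d ; xw₃ = g₁ } ; vu≢s = ≢-sym α≢g₁
      ; reuses-v = ↭-swap g₁ α ↭-refl ; reuses-w₁ = ↭-swap α g₁ ↭-refl ; reuses-w₄ = ↭-refl
      ; reuses-x = ↭-swap d g₁ ↭-refl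
      ; proper-w₂ = (≢-sym g₁≢b₂ ∷ b₂≢d ∷ []) ∷ (b≢d ∷ []) ∷ [] ∷ []
      ; proper-w₃ = (b₃≢c ∷ ≢-sym g₁≢b₃ ∷ []) ∷ (c≢g₁ ∷ []) ∷ [] ∷ [] }

    via-vw₄-swapping-x : c ≡ α → d ≡ g₄ → b₃ ≢ b → a ≢ g₄ → Recolouring old α
    via-vw₄-swapping-x refl refl b₃≢b a≢g₄ = record
      { new = record old { vu = g₄ ; vw₄ = α ; w₃w₄ = g₄ ; xw₂ = g₄ ; xw₃ = b } ; vu≢s = ≢-sym α≢g₄
      ; reuses-v = ↭-exchange g₄ (g₁ ∷ b₂ ∷ b₃ ∷ []) α [] ; reuses-w₁ = ↭-refl
      ; reuses-w₄ = ↭-swap α g₄ ↭-refl ; reuses-x = ↭-swap g₄ b ↭-refl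
      ; proper-w₂ = (b₂≢a ∷ b₂≢g₄ ∷ []) ∷ (a≢g₄ ∷ []) ∷ [] ∷ []
      ; proper-w₃ = (b₃≢g₄ ∷ b₃≢b ∷ []) ∷ (≢-sym b≢d ∷ []) ∷ [] ∷ [] }

    via-vw₄-swapping-all : a ≡ α → b ≡ g₁ → c ≡ g₁ → Recolouring old α
    via-vw₄-swapping-all refl refl refl = record
      { new = mkLinkColouring g₄ α b₃ b₂ g₁ g₁ d g₄ g₁ ; vu≢s = ≢-sym α≢g₄
      ; reuses-v = ↭-trans (↭-exchange g₄ (α ∷ b₃ ∷ b₂ ∷ []) g₁ []) (↭-swap g₁ α (↭-swap b₃ b₂ ↭-refl))
      ; reuses-w₁ = ↭-swap α g₁ ↭-refl ; reuses-w₄ = ↭-swap g₁ g₄ ↭-refl ; reuses-x = ↭-swap d g₁ ↭-refl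
      ; proper-w₂ = (≢-sym g₁≢b₃ ∷ b₃≢d ∷ []) ∷ (b≢d ∷ []) ∷ [] ∷ []
      ; proper-w₃ = (b₂≢g₄ ∷ ≢-sym g₁≢b₂ ∷ []) ∷ (≢-sym g₁≢g₄ ∷ []) ∷ [] ∷ [] }

    via-vw₁-swapping-all : a ≡ g₄ → b ≡ α → c ≡ α → d ≡ g₄ → Recolouring old α
    via-vw₁-swapping-all refl refl refl refl = record
      { new = mkLinkColouring g₁ g₄ b₂ b₃ α g₁ g₄ g₄ α ; vu≢s = ≢-sym α≢g₁
      ; reuses-v = ↭-trans (↭-exchange g₁ (g₄ ∷ b₂ ∷ b₃ ∷ []) α [])
                           (↭-prep α (↭-exchange g₄ (b₂ ∷ b₃ ∷ []) g₁ []))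
      ; reuses-w₁ = ↭-swap g₄ g₁ ↭-refl ; reuses-w₄ = ↭-swap α g₄ ↭-refl ; reuses-x = ↭-swap g₄ α ↭-refl
      ; proper-w₂ = (≢-sym g₁≢b₂ ∷ b₂≢g₄ ∷ []) ∷ (g₁≢g₄ ∷ []) ∷ [] ∷ []
      ; proper-w₃ = (b₃≢g₄ ∷ ≢-sym α≢b₃ ∷ []) ∷ (≢-sym α≢g₄ ∷ []) ∷ [] ∷ [] }

    when-a≡α≡c : a ≡ α → c ≡ α → Recolouring old α
    when-a≡α≡c refl refl with g₁ ≟ᶜ b | g₄ ≟ᶜ d
    ... | no g₁≢b  | _        = via-vw₁ refl g₁≢b
    ... | yes _    | no g₄≢d  = via-vw₄ refl g₄≢d
    ... | yes refl | yes refl = via-vw₁-swapping-x refl refl b₂≢g₄ α≢g₁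

    when-a≡α≡d : a ≡ α → d ≡ α → Recolouring old α
    when-a≡α≡d refl refl with g₁ ≟ᶜ b | c ≟ᶜ g₁
    ... | no g₁≢b  | _        = via-vw₁ refl g₁≢b
    ... | yes refl | no c≢g₁  = via-vw₁-swapping-x refl refl (≢-sym α≢b₂) c≢g₁
    ... | yes refl | yes refl = via-vw₄-swapping-all refl refl refl

    when-b≡α≡c : b ≡ α → c ≡ α → Recolouring old α
    when-b≡α≡c refl refl with g₄ ≟ᶜ d | a ≟ᶜ g₄
    ... | no g₄≢d  | _        = via-vw₄ refl g₄≢d
    ... | yes refl | no a≢g₄  = via-vw₄-swapping-x refl refl (≢-sym α≢b₃) a≢g₄
    ... | yes refl | yes refl = via-vw₁-swapping-all refl refl refl refl

    choose : ∀ s → Recolouring old s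
    choose s with α ≟ᶜ s
    ... | no α≢s = unchanged α≢s
    ... | yes refl with α ≟ᶜ a | α ≟ᶜ b | α ≟ᶜ c | α ≟ᶜ d
    ... | no α≢a   | no α≢b   | _        | _        = via-vw₂ α≢a α≢b
    ... | _        | _        | no α≢c   | no α≢d   = via-vw₃ α≢c α≢d
    ... | yes refl | yes refl | _        | _        = contradiction refl a≢b
    ... | _        | _        | yes refl | yes refl = contradiction refl c≢d
    ... | no _     | yes refl | no _     | yes refl = contradiction refl b≢d
    ... | yes refl | no _     | yes refl | no _     = when-a≡α≡c refl refl
    ... | yes refl | no _     | no _     | yes refl = when-a≡α≡d refl refl
    ... | no _     | yes refl | yes refl | no _     = when-b≡α≡c refl refl

local-recolouring : ∀ {C : Set} → DecidableEquality C → (old : LinkColouring C) →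
                    (∀ i → Unique (around old i)) → ∀ s → Recolouring old s
local-recolouring _≟ᶜ_ (mkLinkColouring α g₁ b₂ b₃ g₄ a b c d) old!
  with old! V | old! W₂ | old! W₃ | old! X
... | (α≢g₁ ∷ α≢b₂ ∷ α≢b₃ ∷ α≢g₄ ∷ []) ∷ (g₁≢b₂ ∷ g₁≢b₃ ∷ g₁≢g₄ ∷ []) ∷ (_ ∷ b₂≢g₄ ∷ []) ∷ (b₃≢g₄ ∷ []) ∷ _
    | (b₂≢a ∷ b₂≢b ∷ []) ∷ (a≢b ∷ []) ∷ _
    | (b₃≢c ∷ b₃≢d ∷ []) ∷ (c≢d ∷ []) ∷ _
    | (b≢d ∷ []) ∷ _
    = Moves.choose _≟ᶜ_ α g₁ b₂ b₃ g₄ a b c d α≢g₁ α≢b₂ α≢b₃ α≢g₄ g₁≢b₂ g₁≢b₃ g₁≢g₄ b₂≢g₄ b₃≢g₄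
                        b₂≢a b₂≢b a≢b b₃≢c b₃≢d c≢d b≢d

record Figure6d {n} (G : Graph n) : Set where
  field
    v u w₁ w₂ w₃ w₄ x : Fin n
    distinct : VecUnique.Unique (v ∷ u ∷ w₁ ∷ w₂ ∷ w₃ ∷ w₄ ∷ x ∷ [])
    v-u   : E G v u
    v-w₁  : E G v w₁
    v-w₂  : E G v w₂
    v-w₃  : E G v w₃
    v-w₄  : E G v w₄
    w₁-w₂ : E G w₁ w₂
    x-w₂  : E G x w₂
    w₃-w₄ : E G w₃ w₄
    x-w₃  : E G x w₃
    deg-v  : deg G v ≡ 8
    deg-u  : deg G u ≡ 2
    deg-w₂ : deg G w₂ ≡ 3
    deg-w₃ : deg G w₃ ≡ 3

-- The neighbours of each vertex in the pattern, except u: the edge vu is not coloured by ψ.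
pattern-neighbours : Role → List Role
pattern-neighbours V  = W₁ ∷ W₂ ∷ W₃ ∷ W₄ ∷ []
pattern-neighbours U  = []
pattern-neighbours W₁ = V ∷ W₂ ∷ []
pattern-neighbours W₂ = V ∷ W₁ ∷ X ∷ []
pattern-neighbours W₃ = V ∷ W₄ ∷ X ∷ []
pattern-neighbours W₄ = V ∷ W₃ ∷ []
pattern-neighbours X  = W₂ ∷ W₃ ∷ []

pattern-neighbours-unique : ∀ i → Unique (pattern-neighbours i)
pattern-neighbours-unique = from-yes (all? λ i → unique? (pattern-neighbours i))
  where open DecUnique _≟_ using (unique?)

pattern-neighbours-adjacent : ∀ i → All (E Pattern i) (pattern-neighbours i)
pattern-neighbours-adjacent = from-yes (all? λ i → All.all? (E? Pattern i) (pattern-neighbours i))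

module Reduction {n} {G : Graph n} (F : Figure6d G)
  (ψ : TotalColoring (deleteEdge G (Figure6d.u F) (Figure6d.v F)) 9) where

  open Figure6d F
  module ψ = TotalColoring ψ

  H : Graph n
  H = deleteEdge G u v

  at : Role → Fin n
  at = Vec.lookup (v ∷ u ∷ w₁ ∷ w₂ ∷ w₃ ∷ w₄ ∷ x ∷ [])

  at-injective : ∀ {i j} → at i ≡ at j → i ≡ j
  at-injective = VecUniqueProperties.lookup-injective distinct _ _

  S : List (Fin n)
  S = u ∷ w₂ ∷ w₃ ∷ []

  survives : ∀ {p q} → E G p q → p ≢ u → q ≢ u → E H p q
  survives {p} {q} e p≢u q≢u with E? H p q
  ... | yes e′ = e′
  ... | no ¬e′ with deleteEdge-only-uw G u v e ¬e′
  ...   | inj₁ (p≡u , _) = contradiction p≡u p≢u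
  ...   | inj₂ (_ , q≡u) = contradiction q≡u q≢u

  role-edge : ∀ i j → E G (at i) (at j) → i ≢ U → j ≢ U → E H (at i) (at j)
  role-edge i j e i≢U j≢U = survives e (i≢U ∘ at-injective) (j≢U ∘ at-injective)

  v-w₁ᴴ : E H v w₁
  v-w₁ᴴ = role-edge V W₁ v-w₁ (λ ()) (λ ())
  v-w₂ᴴ : E H v w₂
  v-w₂ᴴ = role-edge V W₂ v-w₂ (λ ()) (λ ())
  v-w₃ᴴ : E H v w₃
  v-w₃ᴴ = role-edge V W₃ v-w₃ (λ ()) (λ ())
  v-w₄ᴴ : E H v w₄
  v-w₄ᴴ = role-edge V W₄ v-w₄ (λ ()) (λ ())
  w₁-w₂ᴴ : E H w₁ w₂
  w₁-w₂ᴴ = role-edge W₁ W₂ w₁-w₂ (λ ()) (λ ())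
  x-w₂ᴴ : E H x w₂
  x-w₂ᴴ = role-edge X W₂ x-w₂ (λ ()) (λ ())
  w₃-w₄ᴴ : E H w₃ w₄
  w₃-w₄ᴴ = role-edge W₃ W₄ w₃-w₄ (λ ()) (λ ())
  x-w₃ᴴ : E H x w₃
  x-w₃ᴴ = role-edge X W₃ x-w₃ (λ ()) (λ ())

  neighbour-colours : Role → List (Fin 9)
  neighbour-colours i = map (ψ.ecol (at i)) (map at (pattern-neighbours i))

  neighbour-edges : ∀ i → All (E H (at i)) (map at (pattern-neighbours i))
  neighbour-edges V  = v-w₁ᴴ ∷ v-w₂ᴴ ∷ v-w₃ᴴ ∷ v-w₄ᴴ ∷ []
  neighbour-edges U  = []
  neighbour-edges W₁ = E-sym H v-w₁ᴴ ∷ w₁-w₂ᴴ ∷ []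
  neighbour-edges W₂ = E-sym H v-w₂ᴴ ∷ E-sym H w₁-w₂ᴴ ∷ E-sym H x-w₂ᴴ ∷ []
  neighbour-edges W₃ = E-sym H v-w₃ᴴ ∷ w₃-w₄ᴴ ∷ E-sym H x-w₃ᴴ ∷ []
  neighbour-edges W₄ = E-sym H v-w₄ᴴ ∷ E-sym H w₃-w₄ᴴ ∷ []
  neighbour-edges X  = x-w₂ᴴ ∷ x-w₃ᴴ ∷ []

  neighbour-images : ∀ i → All (EdgeImage Pattern at (at i)) (map at (pattern-neighbours i))
  neighbour-images i = All-map⁺ (All.map (λ {j} e → i , j , refl , refl , e) (pattern-neighbours-adjacent i))

  neighbours-distinct : ∀ i → Unique (map at (pattern-neighbours i))
  neighbours-distinct i = Unique-map⁺ at-injective (pattern-neighbours-unique i)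

  H⊆G : ∀ {p q} → E H p q → E G p q
  H⊆G = deleteEdge-⊆ G u v

  uv∉H : ¬ E H u v
  uv∉H = deleteEdge-removes G u v

  α-exists : ∃[ c ] (ψ.vcol v ≢ c × ∀ {r} → E H v r → ψ.ecol v r ≢ c)
  α-exists = missing-at ψ v
    (s≤s (subst (deg H v <_) deg-v (deg-subgraph-< {G = G} {H} H⊆G v-u (uv∉H ∘ E-sym H))))

  α : Fin 9
  α = proj₁ α-exists

  vcol≢α : ψ.vcol v ≢ α
  vcol≢α = proj₁ (proj₂ α-exists)

  α-missing : ∀ {r} → E H v r → ψ.ecol v r ≢ α
  α-missing = proj₂ (proj₂ α-exists)

  z-exists : ∃[ z ] ∀ {q} → E H u q → q ≡ z
  z-exists = sole-neighbour H
    (≤-pred (subst (deg H u <_) deg-u (deg-subgraph-< {G = G} {H} H⊆G (E-sym G v-u) uv∉H)))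

  z : Fin n
  z = proj₁ z-exists

  only-z : ∀ {q} → E H u q → q ≡ z
  only-z = proj₂ z-exists

  s : Fin 9
  s = ψ.ecol u z

  old : LinkColouring (Fin 9)
  old = mkLinkColouring α (ψ.ecol v w₁) (ψ.ecol v w₂) (ψ.ecol v w₃) (ψ.ecol v w₄)
                          (ψ.ecol w₁ w₂) (ψ.ecol x w₂) (ψ.ecol w₃ w₄) (ψ.ecol x w₃)

  around-old : ∀ i → i ≢ V → i ≢ U → around old i ≡ neighbour-colours i
  around-old V  V≢V _ = contradiction refl V≢V
  around-old U  _ U≢U = contradiction refl U≢U
  around-old W₁ _ _ = cong (_∷ ψ.ecol w₁ w₂ ∷ []) (ψ.ecol-sym v w₁ v-w₁ᴴ)
  around-old W₂ _ _ = cong₂ _∷_ (ψ.ecol-sym v w₂ v-w₂ᴴ)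
                        (cong₂ _∷_ (ψ.ecol-sym w₁ w₂ w₁-w₂ᴴ) (cong (_∷ []) (ψ.ecol-sym x w₂ x-w₂ᴴ)))
  around-old W₃ _ _ = cong₂ _∷_ (ψ.ecol-sym v w₃ v-w₃ᴴ)
                        (cong (ψ.ecol w₃ w₄ ∷_) (cong (_∷ []) (ψ.ecol-sym x w₃ x-w₃ᴴ)))
  around-old W₄ _ _ = cong₂ _∷_ (ψ.ecol-sym v w₄ v-w₄ᴴ) (cong (_∷ []) (ψ.ecol-sym w₃ w₄ w₃-w₄ᴴ))
  around-old X  _ _ = refl

  colours-unique : ∀ {p qs} → Unique qs → All (E H p) qs → Unique (map (ψ.ecol p) qs)
  colours-unique [] [] = []
  colours-unique {p} (q∉qs ∷ qs!) (e ∷ es) =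
    All-map⁺ (All.zipWith (λ (q≢r , e′) → ψ.edge-proper p _ _ e e′ q≢r) (q∉qs , es)) ∷ colours-unique qs! es

  via-neighbour-colours : ∀ (P : Role → List (Fin 9) → Set) → (∀ i → P i (neighbour-colours i)) →
                  ∀ i → i ≢ V → i ≢ U → P i (around old i)
  via-neighbour-colours P p i i≢V i≢U = subst (P i) (sym (around-old i i≢V i≢U)) (p i)

  old-proper : ∀ i → Unique (around old i)
  old-proper i with i ≟ V | i ≟ U
  ... | yes refl | _        = All-map⁺ (All.map (≢-sym ∘ α-missing) (neighbour-edges V))
                            ∷ colours-unique (neighbours-distinct V) (neighbour-edges V)
  ... | _        | yes refl = [] ∷ []
  ... | no i≢V   | no i≢U   =
    via-neighbour-colours (λ _ → Unique) (λ i → colours-unique (neighbours-distinct i) (neighbour-edges i))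
                          i i≢V i≢U

  Reusable : Fin n → Fin 9 → Set
  Reusable p c = ψ.vcol p ≢ c × (∀ {r} → E H p r → ¬ EdgeImage Pattern at p r → ψ.ecol p r ≢ c)

  recoloured-reusable : ∀ {p q} → E H p q × EdgeImage Pattern at p q → Reusable p (ψ.ecol p q)
  recoloured-reusable {p} {q} (e , image) =
    ψ.incid-proper p q e , λ {r} e′ ¬image → ψ.edge-proper p r q e′ e λ { refl → ¬image image }

  neighbour-colours-reusable : ∀ i → All (Reusable (at i)) (neighbour-colours i)
  neighbour-colours-reusable i =
    All-map⁺ (All.zipWith recoloured-reusable (neighbour-edges i , neighbour-images i))

  reusable : ∀ i → i ≢ U → All (Reusable (at i)) (around old i)
  reusable i i≢U with i ≟ V
  ... | yes refl = (vcol≢α , λ e _ → α-missing e) ∷ neighbour-colours-reusable V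
  ... | no i≢V   =
    via-neighbour-colours (λ i → All (Reusable (at i))) neighbour-colours-reusable i i≢V i≢U

  recolouring : Recolouring old s
  recolouring = local-recolouring _≟_ old old-proper s

  open Recolouring recolouring

  κ : ProperEdgeColouring Pattern (Fin 9)
  κ = pattern-colouring new (proper old-proper)

  open EmbeddedRecolouring {G = G} ψ S at at-injective κ

  reused : ∀ {i j} → i ≢ U → around new i ↭ around old i → E Pattern i j →
           Reusable (at i) (new ⟦ linkOf i j ⟧)
  reused {i} {j} i≢U reuses e =
    All.lookup (reusable i i≢U) (∈-resp-↭ reuses (∈-map⁺ (new ⟦_⟧) (linkOf-around i j e)))

  every-edge-recoloured : ∀ {i r} → deg G (at i) ≡ length (pattern-neighbours i) → E H (at i) r →
                          EdgeImage Pattern at (at i) r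
  every-edge-recoloured {i} d e = All.lookup (neighbour-images i)
    (neighbour-among G (neighbours-distinct i) (All.map H⊆G (neighbour-edges i))
                       (trans d (sym (length-map at (pattern-neighbours i)))) (H⊆G e))

  only-vu : ∀ {l} → l ∈ linksAt U → l ≡ VU
  only-vu (here l≡VU) = l≡VU

  fresh : ∀ {i j r} → E Pattern i j → E H (at i) r → ¬ EdgeImage Pattern at (at i) r →
          ψ.ecol (at i) r ≢ new ⟦ linkOf i j ⟧
  fresh {V}  e = proj₂ (reused (λ ()) reuses-v e)
  fresh {W₁} e = proj₂ (reused (λ ()) reuses-w₁ e)
  fresh {W₄} e = proj₂ (reused (λ ()) reuses-w₄ e)
  fresh {X}  e = proj₂ (reused (λ ()) reuses-x e)
  fresh {U} {j} {r} e e′ _ r-colour = vu≢s (begin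
    new ⟦ VU ⟧            ≡⟨ cong (new ⟦_⟧) (only-vu (linkOf-around U j e)) ⟨
    new ⟦ linkOf U j ⟧    ≡⟨ r-colour ⟨
    ψ.ecol u r            ≡⟨ cong (ψ.ecol u) (only-z e′) ⟩
    s                     ∎)
    where open ≡-Reasoning
  fresh {W₂} _ e′ ¬image = contradiction (every-edge-recoloured {W₂} deg-w₂ e′) ¬image
  fresh {W₃} _ e′ ¬image = contradiction (every-edge-recoloured {W₃} deg-w₃ e′) ¬image

  incid : ∀ {i j} → E Pattern i j → at i ∉ S → ψ.vcol (at i) ≢ new ⟦ linkOf i j ⟧
  incid {V}  e _ = proj₁ (reused (λ ()) reuses-v e)
  incid {W₁} e _ = proj₁ (reused (λ ()) reuses-w₁ e)
  incid {W₄} e _ = proj₁ (reused (λ ()) reuses-w₄ e)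
  incid {X}  e _ = proj₁ (reused (λ ()) reuses-x e)
  incid {U}  _ ∉S = contradiction (here refl) ∉S
  incid {W₂} _ ∉S = contradiction (there (here refl)) ∉S
  incid {W₃} _ ∉S = contradiction (there (there (here refl))) ∉S

  compatible : Compatible
  compatible = record
    { deleted-recoloured = deleted-recoloured
    ; deleted-touches-S  = deleted-touches-S
    ; fresh = fresh
    ; incid = incid }
    where
    deleted-recoloured : ∀ {p q} → E G p q → ¬ E H p q → EdgeImage Pattern at p q
    deleted-recoloured e ¬e′ with deleteEdge-only-uw G u v e ¬e′
    ... | inj₁ (refl , refl) = U , V , refl , refl , refl
    ... | inj₂ (refl , refl) = V , U , refl , refl , refl

    deleted-touches-S : ∀ {p q} → E G p q → ¬ E H p q → p ∈ S ⊎ q ∈ S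
    deleted-touches-S e ¬e′ with deleteEdge-only-uw G u v e ¬e′
    ... | inj₁ (refl , _) = inj₁ (here refl)
    ... | inj₂ (_ , refl) = inj₂ (here refl)

  reduced : TotalColoringExcept G 9 S
  reduced = recolour compatible

figure6d : ∀ {n} {G : Graph n} → Config6d G → Figure6d G
figure6d {G = G} (v , w₁ , w₂ , w₃ , w₄ , u , x , deg-v ,
                  (w₁≢w₂ , w₁≢w₃ , w₁≢w₄ , w₁≢u , w₂≢w₃ , w₂≢w₄ , w₂≢u , w₃≢w₄ , w₃≢u , w₄≢u) ,
                  (v-w₁ , v-w₂ , v-w₃ , v-w₄ , v-u) , (x≢v , ¬v-x) ,
                  (w₁-w₂ , w₃-w₄ , x-w₂ , x-w₃) , (deg-w₂ , deg-w₃ , deg-u)) = record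
  { v = v ; u = u ; w₁ = w₁ ; w₂ = w₂ ; w₃ = w₃ ; w₄ = w₄ ; x = x
  ; distinct = (v≢ v-u ∷ v≢ v-w₁ ∷ v≢ v-w₂ ∷ v≢ v-w₃ ∷ v≢ v-w₄ ∷ ≢-sym x≢v ∷ [])
             ∷ (≢-sym w₁≢u ∷ ≢-sym w₂≢u ∷ ≢-sym w₃≢u ∷ ≢-sym w₄≢u ∷ ≢x v-u ∷ [])
             ∷ (w₁≢w₂ ∷ w₁≢w₃ ∷ w₁≢w₄ ∷ ≢x v-w₁ ∷ [])
             ∷ (w₂≢w₃ ∷ w₂≢w₄ ∷ ≢x v-w₂ ∷ [])
             ∷ (w₃≢w₄ ∷ ≢x v-w₃ ∷ [])
             ∷ (≢x v-w₄ ∷ [])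
             ∷ [] ∷ []
  ; v-u = v-u ; v-w₁ = v-w₁ ; v-w₂ = v-w₂ ; v-w₃ = v-w₃ ; v-w₄ = v-w₄
  ; w₁-w₂ = w₁-w₂ ; x-w₂ = x-w₂ ; w₃-w₄ = w₃-w₄ ; x-w₃ = x-w₃
  ; deg-v = deg-v ; deg-u = deg-u ; deg-w₂ = deg-w₂ ; deg-w₃ = deg-w₃ }
  where
  v≢ : ∀ {q} → E G v q → v ≢ q
  v≢ = E-irrefl G
  ≢x : ∀ {q} → E G v q → q ≢ x
  ≢x e refl = ¬v-x e

lemma2p13 : ∀ {n} (G : Graph n) → MinimalCounterexample G → ¬ Config6d G
lemma2p13 G mc config = notColorable (recolour-vertices {G = G} small-degrees (Reduction.reduced F ψ))
  where
  open MinimalCounterexample mc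
  F : Figure6d G
  F = figure6d config
  open Figure6d F
  ψ : TotalColoring (deleteEdge G u v) 9
  ψ = edgeDel u v (E-sym G v-u)
  twice-below-9 : ∀ {p} d → deg G p ≡ d → 2 * d < 9 → 2 * deg G p < 9
  twice-below-9 _ deg≡d = subst (λ d → 2 * d < 9) (sym deg≡d)
  small-degrees : All (λ p → 2 * deg G p < 9) (u ∷ w₂ ∷ w₃ ∷ [])
  small-degrees = twice-below-9 2 deg-u (from-yes (2 * 2 <? 9))
                ∷ twice-below-9 3 deg-w₂ (from-yes (2 * 3 <? 9))
                ∷ twice-below-9 3 deg-w₃ (from-yes (2 * 3 <? 9)) ∷ []
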